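{- Let $L\dashv F$ be an arboreal adjunction, with $F\colon\mathcal{E}\to\mathcal{A}$ right adjoint to $L\colon\mathcal{A}\to\mathcal{E}$, $\mathcal{A}$ an arboreal category, and suppose it has the bisimilar companion property. Then for every full subcategory $\mathcal{D}$ of $\mathcal{E}$ saturated under $F$-bisimilarity, $\mathcal{D}$ is closed under morphisms if and only if it is upwards closed with respect to $\to_F$.
   Context: An arboreal category is a category with a stable proper factorisation system (quotients, embeddings) satisfying: coproducts of paths exist and paths are connected; 2-out-of-3 for quotients between paths; every object is the colimit of the paths embedding into it (a path being an object whose poset of embedded subobjects is a finite linear order). In an arboreal category, a pathwise embedding is a morphism $f$ such that $f\circ m$ is an embedding for every embedding $m$ whose domain is a path; $f\colon X\to Y$ is open if every commutative square $f\circ m=q\circ j$ with $m,j,q$ embeddings between/from paths ($m\colon P\to X$, $j\colon P\to Q$, $q\colon Q\to Y$) has a diagonal $d\colon Q\to X$ with $d\circ j=m$ and $f\circ d=q$; objects are bisimilar if there is a span of open pathwise embeddings between them. An arboreal adjunction is any adjunction $L\dashv F$ with $F\colon\mathcal{E}\to\mathcal{A}$ and $\mathcal{A}$ arboreal. For objects $a,b$ of $\mathcal{E}$: $a\leftrightarrow_F b$ ($F$-bisimilar) iff $Fa$ and $Fb$ are bisimilar in $\mathcal{A}$; $a\to_F b$ iff there is an arrow $Fa\to Fb$ in $\mathcal{A}$. The adjunction has the bisimilar companion property if $a\leftrightarrow_F LF(a)$ for all objects $a$ of $\mathcal{E}$. A full subcategory $\mathcal{D}$ is closed under morphisms if an arrow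 $a\to b$ with $a\in\mathcal{D}$ implies $b\in\mathcal{D}$; it is upwards closed with respect to a relation $\nabla$ if $a\in\mathcal{D}$ and $a\mathbin{\nabla}b$ imply $b\in\mathcal{D}$; saturated under $\leftrightarrow_F$ means upwards closed with respect to $\leftrightarrow_F$. -}

module Defs where

open import Level using (Level; _⊔_; suc)
open import Data.Nat using (ℕ)
open import Data.Fin using (Fin)
open import Data.Product using (Σ; Σ-syntax; ∃; _×_; _,_; proj₁; proj₂)
open import Data.Sum using (_⊎_)
open import Relation.Binary using (IsEquivalence)

record Category (o ℓ e : Level) : Set (suc (o ⊔ ℓ ⊔ e)) where
  infixr 9 _∘_
  infix  4 _≈_
  field
    Obj   : Set o
    Hom   : Obj → Obj → Set ℓ
    _≈_   : ∀ {A B} → Hom A B → Hom A B → Set e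
    id    : ∀ {A} → Hom A A
    _∘_   : ∀ {A B C} → Hom B C → Hom A B → Hom A C
    equiv : ∀ {A B} → IsEquivalence (_≈_ {A} {B})
    assoc : ∀ {A B C D} {f : Hom A B} {g : Hom B C} {h : Hom C D} →
            (h ∘ g) ∘ f ≈ h ∘ (g ∘ f)
    identityˡ : ∀ {A B} {f : Hom A B} → id ∘ f ≈ f
    identityʳ : ∀ {A B} {f : Hom A B} → f ∘ id ≈ f
    ∘-resp-≈  : ∀ {A B C} {f h : Hom B C} {g i : Hom A B} →
                f ≈ h → g ≈ i → f ∘ g ≈ h ∘ i

record Functor {o ℓ e o′ ℓ′ e′ : Level}
               (C : Category o ℓ e) (D : Category o′ ℓ′ e′)
               : Set (o ⊔ ℓ ⊔ e ⊔ o′ ⊔ ℓ′ ⊔ e′) where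
  private
    module C = Category C
    module D = Category D
  field
    F₀ : C.Obj → D.Obj
    F₁ : ∀ {A B} → C.Hom A B → D.Hom (F₀ A) (F₀ B)
    identity     : ∀ {A} → F₁ (C.id {A}) D.≈ D.id
    homomorphism : ∀ {A B C} {f : C.Hom A B} {g : C.Hom B C} →
                   F₁ (g C.∘ f) D.≈ F₁ g D.∘ F₁ f
    F-resp-≈     : ∀ {A B} {f g : C.Hom A B} → f C.≈ g → F₁ f D.≈ F₁ g

record Adjunction {o ℓ e o′ ℓ′ e′ : Level}
                  {C : Category o ℓ e} {D : Category o′ ℓ′ e′}
                  (L : Functor C D) (R : Functor D C)
                  : Set (o ⊔ ℓ ⊔ e ⊔ o′ ⊔ ℓ′ ⊔ e′) where
  private
    module C = Category C
    module D = Category D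
    module L = Functor L
    module R = Functor R
  field
    unit   : ∀ (A : C.Obj) → C.Hom A (R.F₀ (L.F₀ A))
    counit : ∀ (B : D.Obj) → D.Hom (L.F₀ (R.F₀ B)) B
    unit-natural   : ∀ {A A′} (f : C.Hom A A′) →
                     unit A′ C.∘ f C.≈ R.F₁ (L.F₁ f) C.∘ unit A
    counit-natural : ∀ {B B′} (g : D.Hom B B′) →
                     counit B′ D.∘ L.F₁ (R.F₁ g) D.≈ g D.∘ counit B
    zig : ∀ {A} → counit (L.F₀ A) D.∘ L.F₁ (unit A) D.≈ D.id
    zag : ∀ {B} → R.F₁ (counit B) C.∘ unit (R.F₀ B) C.≈ C.id

module CatNotions {o ℓ e : Level} (C : Category o ℓ e) where
  open Category C

  Epi : ∀ {A B} → Hom A B → Set (o ⊔ ℓ ⊔ e)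
  Epi {A} {B} f = ∀ {X} (g h : Hom B X) → g ∘ f ≈ h ∘ f → g ≈ h

  Mono : ∀ {A B} → Hom A B → Set (o ⊔ ℓ ⊔ e)
  Mono {A} {B} f = ∀ {X} (g h : Hom X A) → f ∘ g ≈ f ∘ h → g ≈ h

  IsIso : ∀ {A B} → Hom A B → Set (ℓ ⊔ e)
  IsIso {A} {B} f = Σ[ g ∈ Hom B A ] (g ∘ f ≈ id × f ∘ g ≈ id)

  record IsPullback {X Y Z P : Obj} (f : Hom X Z) (g : Hom Y Z)
                    (p₁ : Hom P X) (p₂ : Hom P Y) : Set (o ⊔ ℓ ⊔ e) where
    field
      commute   : f ∘ p₁ ≈ g ∘ p₂
      universal : ∀ {W} (h₁ : Hom W X) (h₂ : Hom W Y) → f ∘ h₁ ≈ g ∘ h₂ →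
                  Σ[ u ∈ Hom W P ] ((p₁ ∘ u ≈ h₁ × p₂ ∘ u ≈ h₂) ×
                    (∀ (v : Hom W P) → p₁ ∘ v ≈ h₁ → p₂ ∘ v ≈ h₂ → v ≈ u))

  record IsCoproduct {ι : Level} {I : Set ι} (P : I → Obj) (Cp : Obj)
                     (inj : ∀ i → Hom (P i) Cp) : Set (o ⊔ ℓ ⊔ e ⊔ ι) where
    field
      universal : ∀ {W} (h : ∀ i → Hom (P i) W) →
                  Σ[ u ∈ Hom Cp W ] ((∀ i → u ∘ inj i ≈ h i) ×
                    (∀ (v : Hom Cp W) → (∀ i → v ∘ inj i ≈ h i) → v ≈ u))

record ProperStableFactorisationSystem {o ℓ e : Level} (C : Category o ℓ e)
                                       (p : Level)
                                       : Set (suc (o ⊔ ℓ ⊔ e ⊔ p)) where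
  open Category C
  open CatNotions C
  field
    Quotient  : ∀ {A B} → Hom A B → Set p
    Embedding : ∀ {A B} → Hom A B → Set p
    Quotient-resp-≈  : ∀ {A B} {f g : Hom A B} → f ≈ g → Quotient f → Quotient g
    Embedding-resp-≈ : ∀ {A B} {f g : Hom A B} → f ≈ g → Embedding f → Embedding g
    iso⇒Quotient  : ∀ {A B} {f : Hom A B} → IsIso f → Quotient f
    iso⇒Embedding : ∀ {A B} {f : Hom A B} → IsIso f → Embedding f
    Quotient-∘  : ∀ {A B C} {f : Hom A B} {g : Hom B C} →
                  Quotient f → Quotient g → Quotient (g ∘ f)
    Embedding-∘ : ∀ {A B C} {f : Hom A B} {g : Hom B C} →
                  Embedding f → Embedding g → Embedding (g ∘ f)
    factor : ∀ {A B} (f : Hom A B) →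
             Σ[ M ∈ Obj ] Σ[ q ∈ Hom A M ] Σ[ m ∈ Hom M B ]
               (Quotient q × Embedding m × m ∘ q ≈ f)
    diagonal : ∀ {A B X Y} {q : Hom A B} {m : Hom X Y}
               (f : Hom A X) (g : Hom B Y) →
               Quotient q → Embedding m → g ∘ q ≈ m ∘ f →
               Σ[ d ∈ Hom B X ] ((d ∘ q ≈ f × m ∘ d ≈ g) ×
                 (∀ (d′ : Hom B X) → d′ ∘ q ≈ f → m ∘ d′ ≈ g → d′ ≈ d))
    Quotient⇒Epi   : ∀ {A B} {f : Hom A B} → Quotient f → Epi f
    Embedding⇒Mono : ∀ {A B} {f : Hom A B} → Embedding f → Mono f
    stable : ∀ {A B Z} (q : Hom A Z) (m : Hom B Z) → Quotient q → Embedding m →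
             Σ[ P ∈ Obj ] Σ[ p₁ ∈ Hom P A ] Σ[ p₂ ∈ Hom P B ]
               (IsPullback q m p₁ p₂ × Quotient p₂)

module FSNotions {o ℓ e p : Level} (C : Category o ℓ e)
                 (FS : ProperStableFactorisationSystem C p) where
  open Category C
  open CatNotions C
  open ProperStableFactorisationSystem FS

  EmbInto : Obj → Set (o ⊔ ℓ ⊔ p)
  EmbInto X = Σ[ A ∈ Obj ] Σ[ m ∈ Hom A X ] Embedding m

  _≤S_ : ∀ {X} → EmbInto X → EmbInto X → Set (ℓ ⊔ e)
  (A , m , _) ≤S (B , n , _) = Σ[ k ∈ Hom A B ] (n ∘ k ≈ m)

  -- P is a path: its poset of embedded subobjects (embeddings modulo
  -- mutual factorisation) is a finite linear order
  IsPath : Obj → Set (o ⊔ ℓ ⊔ e ⊔ p)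
  IsPath X =
    (∀ (s t : EmbInto X) → s ≤S t ⊎ t ≤S s) ×
    (Σ[ n ∈ ℕ ] Σ[ f ∈ (Fin n → EmbInto X) ]
       (∀ (s : EmbInto X) → Σ[ i ∈ Fin n ] (s ≤S f i × f i ≤S s)))

  IsConnected : (ι : Level) → Obj → Set (o ⊔ ℓ ⊔ e ⊔ p ⊔ suc ι)
  IsConnected ι X =
    ∀ (I : Set ι) (i₀ : I) (P : I → Obj) → (∀ i → IsPath (P i)) →
    ∀ (Cp : Obj) (inj : ∀ i → Hom (P i) Cp) → IsCoproduct P Cp inj →
    ∀ (f : Hom X Cp) → Σ[ i ∈ I ] Σ[ g ∈ Hom X (P i) ] (inj i ∘ g ≈ f)

  PathEmb : Obj → Set (o ⊔ ℓ ⊔ e ⊔ p)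
  PathEmb X = Σ[ P ∈ Obj ] Σ[ m ∈ Hom P X ] (Embedding m × IsPath P)

  IsColimitOfPaths : Obj → Set (o ⊔ ℓ ⊔ e ⊔ p)
  IsColimitOfPaths X =
    ∀ (Y : Obj) (c : (pm : PathEmb X) → Hom (proj₁ pm) Y) →
    -- c is a cocone over the diagram (morphisms k with n ∘ k ≈ m)
    (∀ (pm qn : PathEmb X) (k : Hom (proj₁ pm) (proj₁ qn)) →
       proj₁ (proj₂ qn) ∘ k ≈ proj₁ (proj₂ pm) → c qn ∘ k ≈ c pm) →
    Σ[ u ∈ Hom X Y ] ((∀ (pm : PathEmb X) → u ∘ proj₁ (proj₂ pm) ≈ c pm) ×
      (∀ (v : Hom X Y) → (∀ (pm : PathEmb X) → v ∘ proj₁ (proj₂ pm) ≈ c pm) →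
         v ≈ u))

record Arboreal {o ℓ e : Level} (C : Category o ℓ e) (p ι : Level)
                : Set (suc (o ⊔ ℓ ⊔ e ⊔ p ⊔ ι)) where
  open Category C
  open CatNotions C
  field
    factorisation : ProperStableFactorisationSystem C p
  open ProperStableFactorisationSystem factorisation public
  open FSNotions C factorisation public
  field
    path-coproducts : ∀ (I : Set ι) (P : I → Obj) → (∀ i → IsPath (P i)) →
                      Σ[ Cp ∈ Obj ] Σ[ inj ∈ (∀ i → Hom (P i) Cp) ]
                        IsCoproduct P Cp inj
    paths-connected : ∀ (P : Obj) → IsPath P → IsConnected ι P
    two-of-three : ∀ {P Q R} (f : Hom P Q) (g : Hom Q R) →
                   IsPath P → IsPath Q → IsPath R →
                   ((Quotient f × Quotient g → Quotient (g ∘ f)) ×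
                    (Quotient f × Quotient (g ∘ f) → Quotient g) ×
                    (Quotient g × Quotient (g ∘ f) → Quotient f))
    path-generated : ∀ (X : Obj) → IsColimitOfPaths X

  PathwiseEmbedding : ∀ {X Y} → Hom X Y → Set (o ⊔ ℓ ⊔ e ⊔ p)
  PathwiseEmbedding {X} f =
    ∀ {P} (m : Hom P X) → Embedding m → IsPath P → Embedding (f ∘ m)

  Open : ∀ {X Y} → Hom X Y → Set (o ⊔ ℓ ⊔ e ⊔ p)
  Open {X} {Y} f =
    ∀ {P Q} (m : Hom P X) (j : Hom P Q) (q : Hom Q Y) →
    IsPath P → IsPath Q → Embedding m → Embedding j → Embedding q →
    f ∘ m ≈ q ∘ j →
    Σ[ d ∈ Hom Q X ] (d ∘ j ≈ m × f ∘ d ≈ q)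

  Bisimilar : Obj → Obj → Set (o ⊔ ℓ ⊔ e ⊔ p)
  Bisimilar X Y = Σ[ Z ∈ Obj ] Σ[ f ∈ Hom Z X ] Σ[ g ∈ Hom Z Y ]
                    ((Open f × PathwiseEmbedding f) × (Open g × PathwiseEmbedding g))

module ArborealAdjunctionNotions
  {oA ℓA eA oE ℓE eE p ι : Level}
  {𝒜 : Category oA ℓA eA} {ℰ : Category oE ℓE eE}
  (arb : Arboreal 𝒜 p ι)
  (L : Functor 𝒜 ℰ) (F : Functor ℰ 𝒜) where

  private
    module 𝒜 = Category 𝒜
    module ℰ = Category ℰ
    module L = Functor L
    module F = Functor F
    module arb = Arboreal arb

  _↔F_ : ℰ.Obj → ℰ.Obj → Set (oA ⊔ ℓA ⊔ eA ⊔ p)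
  a ↔F b = arb.Bisimilar (F.F₀ a) (F.F₀ b)

  _→F_ : ℰ.Obj → ℰ.Obj → Set ℓA
  a →F b = 𝒜.Hom (F.F₀ a) (F.F₀ b)

  BisimilarCompanionProperty : Set (oE ⊔ oA ⊔ ℓA ⊔ eA ⊔ p)
  BisimilarCompanionProperty = ∀ (a : ℰ.Obj) → a ↔F L.F₀ (F.F₀ a)

-- Full subcategories (as predicates on objects) and closure properties

module SubcategoryNotions {o ℓ e : Level} (C : Category o ℓ e) where
  open Category C

  ClosedUnderMorphisms : ∀ {q} → (Obj → Set q) → Set (o ⊔ ℓ ⊔ q)
  ClosedUnderMorphisms D = ∀ (a b : Obj) → Hom a b → D a → D b

  UpwardsClosed : ∀ {q r} → (Obj → Set q) → (Obj → Obj → Set r) → Set (o ⊔ q ⊔ r)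
  UpwardsClosed D _∇_ = ∀ (a b : Obj) → D a → a ∇ b → D b

{-# OPTIONS --safe #-}
module Submission where

-- An arrow F a → F b transposes along L ⊣ F to an arrow L F a → b, and L F a
-- lies in D together with a because it is F-bisimilar to a.  Conversely,
-- F sends an arrow a → b to an arrow F a → F b.

open import Defs
open import Level using (Level)
open import Data.Product using (_×_; _,_)

module _ {o ℓ e o′ ℓ′ e′ : Level}
         {𝒜 : Category o ℓ e} {ℰ : Category o′ ℓ′ e′} where
  private
    module 𝒜 = Category 𝒜
    module ℰ = Category ℰ
  open Functor using (F₀; F₁)
  open SubcategoryNotions ℰ

  _⟶[_]_ : ℰ.Obj → Functor ℰ 𝒜 → ℰ.Obj → Set ℓ
  a ⟶[ F ] b = 𝒜.Hom (F₀ F a) (F₀ F b)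

  transpose : {L : Functor 𝒜 ℰ} {F : Functor ℰ 𝒜} → Adjunction L F →
              ∀ {A b} → 𝒜.Hom A (F₀ F b) → ℰ.Hom (F₀ L A) b
  transpose {L = L} adj {b = b} g = Adjunction.counit adj b ℰ.∘ F₁ L g

  closedUnderMorphisms⇒upwardsClosed-⟶ :
    ∀ {q} {L : Functor 𝒜 ℰ} {F : Functor ℰ 𝒜} → Adjunction L F →
    (D : ℰ.Obj → Set q) → ClosedUnderMorphisms D →
    (∀ a → D a → D (F₀ L (F₀ F a))) →
    UpwardsClosed D (_⟶[ F ]_)
  closedUnderMorphisms⇒upwardsClosed-⟶ {L = L} {F = F} adj D closed companion a b Da g =
    closed (F₀ L (F₀ F a)) b (transpose adj g) (companion a Da)

  upwardsClosed-⟶⇒closedUnderMorphisms :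
    ∀ {q} (F : Functor ℰ 𝒜) (D : ℰ.Obj → Set q) →
    UpwardsClosed D (_⟶[ F ]_) → ClosedUnderMorphisms D
  upwardsClosed-⟶⇒closedUnderMorphisms F D up a b f Da = up a b Da (F₁ F f)

module _ {oA ℓA eA oE ℓE eE p ι : Level}
         {𝒜 : Category oA ℓA eA} {ℰ : Category oE ℓE eE}
         (arb : Arboreal 𝒜 p ι) (L : Functor 𝒜 ℰ) (F : Functor ℰ 𝒜) where
  open ArborealAdjunctionNotions arb L F
  open SubcategoryNotions ℰ
  open Functor using (F₀)

  saturated⇒companion-closed :
    ∀ {q} → BisimilarCompanionProperty → (D : Category.Obj ℰ → Set q) →
    UpwardsClosed D _↔F_ → ∀ a → D a → D (F₀ L (F₀ F a))
  saturated⇒companion-closed companion D saturated a Da =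
    saturated a (F₀ L (F₀ F a)) Da (companion a)

proposition9p8 : ∀ {oA ℓA eA oE ℓE eE p ι q : Level}
    {𝒜 : Category oA ℓA eA} {ℰ : Category oE ℓE eE}
    (arb : Arboreal 𝒜 p ι)
    (L : Functor 𝒜 ℰ) (F : Functor ℰ 𝒜) (adj : Adjunction L F) →
    ArborealAdjunctionNotions.BisimilarCompanionProperty arb L F →
    ∀ (D : Category.Obj ℰ → Set q) →
    SubcategoryNotions.UpwardsClosed ℰ D (ArborealAdjunctionNotions._↔F_ arb L F) →
    (SubcategoryNotions.ClosedUnderMorphisms ℰ D →
       SubcategoryNotions.UpwardsClosed ℰ D (ArborealAdjunctionNotions._→F_ arb L F)) ×
    (SubcategoryNotions.UpwardsClosed ℰ D (ArborealAdjunctionNotions._→F_ arb L F) →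
       SubcategoryNotions.ClosedUnderMorphisms ℰ D)
proposition9p8 arb L F adj companion D saturated =
  (λ closed → closedUnderMorphisms⇒upwardsClosed-⟶ adj D closed
                (saturated⇒companion-closed arb L F companion D saturated)) ,
  upwardsClosed-⟶⇒closedUnderMorphisms F D
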